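{- Let $G$ be a finite, simple, connected graph with an even number $n$ of vertices. Then every optimal solution $S_{opt}$ to the Minimum Edge-Vertex Problem for $G$ satisfies $n/2\le |S_{opt}|\le n-1$. Both bounds are best possible: for every even $n\ge 2$ there is a connected graph of order $n$ whose optimal solutions have exactly $n/2$ edges (e.g. any connected graph of order $n$ with a perfect matching), and a connected graph of order $n$ whose optimal solution has exactly $n-1$ edges (e.g. the star $K_{1,n-1}$).
   Context: For a graph $G=(V,E)$, a solution to the Edge-Vertex Problem is a subset $X\subseteq E$ such that for every vertex $v\in V$ the number of edges of $X$ incident with $v$ is odd. The Minimum Edge-Vertex Problem asks for a solution of minimum cardinality; such a solution is called optimal. -}

module Defs where

open import Data.Nat using (ℕ; zero; suc; _+_; _*_; _≤_; _%_; _<ᵇ_)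
open import Data.Bool using (Bool; true; false; _∧_; if_then_else_)
open import Data.Fin using (Fin; toℕ)
open import Data.Product using (_×_)
open import Relation.Binary.PropositionalEquality using (_≡_)
open import Relation.Binary.Construct.Closure.ReflexiveTransitive using (Star)

count : ∀ {n} → (Fin n → Bool) → ℕ
count {zero}  p = 0
count {suc n} p = (if p Fin.zero then 1 else 0) + count {n} (λ i → p (Fin.suc i))

sumFin : ∀ {n} → (Fin n → ℕ) → ℕ
sumFin {zero}  f = 0
sumFin {suc n} f = f Fin.zero + sumFin {n} (λ i → f (Fin.suc i))

record Graph (n : ℕ) : Set where
  field
    Adj    : Fin n → Fin n → Bool
    sym    : ∀ i j → Adj i j ≡ Adj j i
    irrefl : ∀ i → Adj i i ≡ false
open Graph public

Connected : ∀ {n} → Graph n → Set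
Connected {n} G = ∀ (u v : Fin n) → Star (λ a b → Adj G a b ≡ true) u v

record EdgeSubset {n : ℕ} (G : Graph n) : Set where
  field
    mem    : Fin n → Fin n → Bool
    memSym : ∀ i j → mem i j ≡ mem j i
    sub    : ∀ i j → mem i j ≡ true → Adj G i j ≡ true
open EdgeSubset public

-- cardinality |X|: number of unordered pairs {i,j}, i < j, in X
size : ∀ {n} {G : Graph n} → EdgeSubset G → ℕ
size X = sumFin (λ i → count (λ j → (toℕ i <ᵇ toℕ j) ∧ mem X i j))

deg : ∀ {n} {G : Graph n} → EdgeSubset G → Fin n → ℕ
deg X v = count (λ j → mem X v j)

-- solution to the Edge-Vertex Problem: every vertex has odd X-degree
IsSolution : ∀ {n} {G : Graph n} → EdgeSubset G → Set
IsSolution {n} X = ∀ (v : Fin n) → deg X v % 2 ≡ 1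

IsOptimal : ∀ {n} {G : Graph n} → EdgeSubset G → Set
IsOptimal {n} {G} X = IsSolution X × (∀ (Y : EdgeSubset G) → IsSolution Y → size X ≤ size Y)

-- Lower bound: in a solution S every degree is odd, hence positive, so n ≤ Σ deg = 2|S|.
-- Upper bound: if |S| ≥ n, the incidence vectors of the edges of S are at least n vectors of
-- even weight in GF(2)^n, so they lie in a subspace of dimension n - 1 and are linearly
-- dependent.  A dependence is a nonempty edge set C ⊆ S in which every degree is even, and
-- then S ∖ C is a strictly smaller solution.  The bounds are attained by a perfect matching
-- of K_n and by the star K_{1,n-1}, whose only solution is its whole edge set.
module Submission where

open import Defs hiding (sym)
open import Algebra.Bundles using (Monoid; CommutativeRing)
import Algebra.Properties.Monoid.Sum as MonoidSum
import Algebra.Properties.Semiring.Sum as SemiringSum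
open import Data.Bool using (Bool; true; false; not; _∧_; _xor_; if_then_else_)
open import Data.Bool.Properties
  using (∧-identityʳ; ∧-zeroʳ; ∧-assoc; ∧-distribˡ-xor; xor-same; xor-comm;
         xor-identityʳ; not-involutive; not-distribˡ-xor; xor-∧-commutativeRing)
  renaming (_≟_ to _≟ᵇ_)
open import Data.Fin using (Fin; zero; suc; toℕ; punchIn; combine; remQuot; _↑ˡ_; _↑ʳ_)
open import Data.Fin.Properties
  using (_≟_; toℕ-injective; any?; punchInᵢ≢i; punchIn-punchOut; remQuot-combine; combine-remQuot)
open import Data.Nat using (ℕ; zero; suc; pred; _+_; _*_; _≤_; _<_; _%_; _<ᵇ_; z≤n; s≤s)
open import Data.Nat.Properties
  using (+-*-semiring; +-0-monoid; +-comm; +-identityʳ; *-comm; m≤m+n; m<m+n; ≤-trans; ≤-pred;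
         +-mono-≤; ≤-antisym; ≤-reflexive; <⇒≤; <⇒≱; ≰⇒>; *-cancelˡ-≤; *-cancelˡ-≡; _≤?_)
open import Data.Product using (_×_; Σ; ∃; _,_; proj₁; proj₂; uncurry)
open import Data.Vec.Functional using (insertAt)
open import Data.Vec.Functional.Properties using (insertAt-lookup; insertAt-punchIn)
open import Function using (_∘_)
open import Relation.Binary.Construct.Closure.ReflexiveTransitive using (ε; _◅_)
open import Relation.Binary.PropositionalEquality
open import Relation.Nullary using (yes; no; does; contradiction)
open import Relation.Nullary.Decidable using (dec-true; dec-false)

open ≡-Reasoning

module ℕΣ = SemiringSum +-*-semiring
module 𝔹Σ = SemiringSum (CommutativeRing.semiring xor-∧-commutativeRing)
open ℕΣ using (sum)
open 𝔹Σ using () renaming (sum to ⨁)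

xor-monoid : Monoid _ _
xor-monoid = CommutativeRing.+-monoid xor-∧-commutativeRing

𝟙 : Bool → ℕ
𝟙 b = if b then 1 else 0

odd? : ℕ → Bool
odd? zero    = false
odd? (suc n) = not (odd? n)

δ : ∀ {n} → Fin n → Fin n → Bool
δ i j = does (i ≟ j)

xor≡false⇒≡ : ∀ {a b} → a xor b ≡ false → a ≡ b
xor≡false⇒≡ {false} {false} _ = refl
xor≡false⇒≡ {true}  {true}  _ = refl

∧≡true : ∀ {a b} → a ∧ b ≡ true → (a ≡ true) × (b ≡ true)
∧≡true {true} {true} _ = refl , refl

∧≡false : ∀ {a b} → (a ≡ true → b ≡ false) → a ∧ b ≡ false
∧≡false {false} _ = refl
∧≡false {true}  h = h refl

∧-not≡xor : ∀ {a b} → (b ≡ true → a ≡ true) → a ∧ not b ≡ a xor b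
∧-not≡xor {true}  {true}  _ = refl
∧-not≡xor {true}  {false} _ = refl
∧-not≡xor {false} {false} _ = refl
∧-not≡xor {false} {true}  h with h refl
... | ()

sumFin≡sum : ∀ {n} (f : Fin n → ℕ) → sumFin f ≡ sum f
sumFin≡sum {zero}  f = refl
sumFin≡sum {suc n} f = cong (f zero +_) (sumFin≡sum (f ∘ suc))

count≡sum : ∀ {n} (p : Fin n → Bool) → count p ≡ sum (𝟙 ∘ p)
count≡sum {zero}  p = refl
count≡sum {suc n} p = cong (𝟙 (p zero) +_) (count≡sum (p ∘ suc))

size≡sum : ∀ {n} {G : Graph n} (X : EdgeSubset G) →
           size X ≡ sum (λ i → sum (λ j → 𝟙 ((toℕ i <ᵇ toℕ j) ∧ mem X i j)))
size≡sum X = trans (sumFin≡sum (λ i → count (λ j → (toℕ i <ᵇ toℕ j) ∧ mem X i j)))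
  (ℕΣ.sum-cong-≗ (λ i → count≡sum (λ j → (toℕ i <ᵇ toℕ j) ∧ mem X i j)))

n≤sumFin : ∀ {n} (f : Fin n → ℕ) → (∀ i → 1 ≤ f i) → n ≤ sumFin f
n≤sumFin {zero}  f _  = z≤n
n≤sumFin {suc n} f f≥1 = +-mono-≤ (f≥1 zero) (n≤sumFin (f ∘ suc) (f≥1 ∘ suc))

sumFin-cong : ∀ {n} {f g : Fin n → ℕ} → (∀ i → f i ≡ g i) → sumFin f ≡ sumFin g
sumFin-cong {f = f} {g} f≡g = trans (sumFin≡sum f) (trans (ℕΣ.sum-cong-≗ f≡g) (sym (sumFin≡sum g)))

sumFin-const-1 : ∀ n → sumFin {n} (λ _ → 1) ≡ n
sumFin-const-1 zero    = refl
sumFin-const-1 (suc n) = cong suc (sumFin-const-1 n)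

≤-sum : ∀ {n} (f : Fin n → ℕ) i → f i ≤ sum f
≤-sum {suc n} f i = subst (f i ≤_) (sym (ℕΣ.sum-remove {i = i} f)) (m≤m+n (f i) _)

count-remove : ∀ {n} (p : Fin (suc n) → Bool) i → count p ≡ 𝟙 (p i) + count (p ∘ punchIn i)
count-remove p i = begin
  count p                           ≡⟨ count≡sum p ⟩
  sum (𝟙 ∘ p)                       ≡⟨ ℕΣ.sum-remove {i = i} (𝟙 ∘ p) ⟩
  𝟙 (p i) + sum (𝟙 ∘ p ∘ punchIn i) ≡⟨ cong (𝟙 (p i) +_) (count≡sum (p ∘ punchIn i)) ⟨
  𝟙 (p i) + count (p ∘ punchIn i)   ∎

count-false : ∀ {n} (p : Fin n → Bool) → (∀ i → p i ≡ false) → count p ≡ 0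
count-false {n} p p≡false =
  trans (count≡sum p) (trans (ℕΣ.sum-cong-≗ (cong 𝟙 ∘ p≡false)) (ℕΣ.sum-replicate-zero n))

count-true : ∀ n → count {n} (λ _ → true) ≡ n
count-true zero    = refl
count-true (suc n) = cong suc (count-true n)

count>0⇒∃ : ∀ {n} (p : Fin n → Bool) → 0 < count p → ∃ λ i → p i ≡ true
count>0⇒∃ {suc n} p 0<p with p zero in p0
... | true  = zero , p0
... | false with count>0⇒∃ (p ∘ suc) 0<p
...   | i , pi = suc i , pi

∃⇒count>0 : ∀ {n} (p : Fin n → Bool) {i} → p i ≡ true → 0 < count p
∃⇒count>0 {suc n} p {i} pi rewrite count-remove p i | pi = s≤s z≤n

module _ {c ℓ} (M : Monoid c ℓ) where
  private module M = Monoid M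
  open MonoidSum M using () renaming (sum to ∑)

  sum-↑ : ∀ {m k} (f : Fin (m + k) → M.Carrier) → ∑ f M.≈ ∑ (f ∘ (_↑ˡ k)) M.∙ ∑ (f ∘ (m ↑ʳ_))
  sum-↑ {zero}  f = M.sym (M.identityˡ _)
  sum-↑ {suc m} f = M.trans (M.∙-congˡ (sum-↑ {m} (f ∘ suc))) (M.sym (M.assoc _ _ _))

  sum-combine : ∀ {m k} (f : Fin (m * k) → M.Carrier) →
                ∑ f M.≈ ∑ (λ (i : Fin m) → ∑ (λ (j : Fin k) → f (combine i j)))
  sum-combine {zero}      f = M.refl
  sum-combine {suc m} {k} f =
    M.trans (sum-↑ {k} {m * k} f) (M.∙-congˡ (sum-combine {m} {k} (f ∘ (k ↑ʳ_))))

atPair : ∀ {m k} {A : Set} → (Fin m → Fin k → A) → Fin (m * k) → A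
atPair {k = k} f e = uncurry f (remQuot k e)

atPair-combine : ∀ {m k} {A : Set} (f : Fin m → Fin k → A) i j → atPair f (combine i j) ≡ f i j
atPair-combine {k = k} f i j = cong (uncurry f) (remQuot-combine {k = k} i j)

odd?-+ : ∀ m n → odd? (m + n) ≡ odd? m xor odd? n
odd?-+ zero    n = refl
odd?-+ (suc m) n = trans (cong not (odd?-+ m n)) (not-distribˡ-xor (odd? m) (odd? n))

odd?-double : ∀ m → odd? (2 * m) ≡ false
odd?-double m = begin
  odd? (m + (m + 0))          ≡⟨ odd?-+ m (m + 0) ⟩
  odd? m xor odd? (m + 0)     ≡⟨ cong (λ x → odd? m xor odd? x) (+-identityʳ m) ⟩
  odd? m xor odd? m           ≡⟨ xor-same (odd? m) ⟩
  false                       ∎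

odd?-pred-double : ∀ k → odd? (pred (2 * suc k)) ≡ true
odd?-pred-double k = trans (sym (not-involutive _)) (cong not (odd?-double (suc k)))

%2≡𝟙odd? : ∀ n → n % 2 ≡ 𝟙 (odd? n)
%2≡𝟙odd? zero          = refl
%2≡𝟙odd? (suc zero)    = refl
%2≡𝟙odd? (suc (suc n)) = trans (%2≡𝟙odd? n) (cong 𝟙 (sym (not-involutive (odd? n))))

odd?-count : ∀ {n} (p : Fin n → Bool) → odd? (count p) ≡ ⨁ p
odd?-count {zero}  p = refl
odd?-count {suc n} p with p zero
... | true  = cong not (odd?-count (p ∘ suc))
... | false = odd?-count (p ∘ suc)

⨁-false : ∀ {n} {p : Fin n → Bool} → (∀ i → p i ≡ false) → ⨁ p ≡ false
⨁-false {n} p≡false = trans (𝔹Σ.sum-cong-≗ p≡false) (𝔹Σ.sum-replicate-zero n)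

δ-refl : ∀ {n} (i : Fin n) → δ i i ≡ true
δ-refl i = dec-true (i ≟ i) refl

δ-sym : ∀ {n} (i j : Fin n) → δ i j ≡ δ j i
δ-sym i j with i ≟ j
... | yes refl = sym (δ-refl i)
... | no  i≢j  = sym (dec-false (j ≟ i) (i≢j ∘ sym))

⨁-δ : ∀ {n} (f : Fin n → Bool) i → ⨁ (λ j → f j ∧ δ j i) ≡ f i
⨁-δ {suc n} f i = begin
  ⨁ (λ j → f j ∧ δ j i)
    ≡⟨ 𝔹Σ.sum-remove {i = i} (λ j → f j ∧ δ j i) ⟩
  (f i ∧ δ i i) xor ⨁ (λ j → f (punchIn i j) ∧ δ (punchIn i j) i)
    ≡⟨ cong₂ _xor_ diagonal (⨁-false off-diagonal) ⟩
  f i xor false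
    ≡⟨ xor-identityʳ (f i) ⟩
  f i
    ∎
  where
  diagonal : f i ∧ δ i i ≡ f i
  diagonal = trans (cong (f i ∧_) (δ-refl i)) (∧-identityʳ (f i))
  off-diagonal : ∀ j → f (punchIn i j) ∧ δ (punchIn i j) i ≡ false
  off-diagonal j = trans (cong (f (punchIn i j) ∧_) (dec-false (punchIn i j ≟ i) (punchInᵢ≢i i j)))
                         (∧-zeroʳ _)

-- Linear dependence over GF(2)

record Dependence {m d} (v : Fin m → Fin d → Bool) (s : Fin m → Bool) : Set where
  field
    coeff      : Fin m → Bool
    nontrivial : ∃ λ i → coeff i ≡ true
    supported  : ∀ i → coeff i ≡ true → s i ≡ true
    vanishes   : ∀ c → ⨁ (λ i → coeff i ∧ v i c) ≡ false

dependence-drop-zero : ∀ {m d} {v : Fin m → Fin (suc d) → Bool} {s : Fin m → Bool} →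
                       (∀ i → s i ≡ true → v i zero ≡ false) →
                       Dependence (λ i c → v i (suc c)) s → Dependence v s
dependence-drop-zero zero-column D = record
  { coeff      = coeff
  ; nontrivial = nontrivial
  ; supported  = supported
  ; vanishes   = λ { zero → ⨁-false (λ i → ∧≡false (zero-column i ∘ supported i))
                   ; (suc c) → vanishes c }
  }
  where
  open Dependence D

module Pivot {m d} (v : Fin (suc m) → Fin (suc d) → Bool) (s : Fin (suc m) → Bool)
             (p : Fin (suc m)) (sp : s p ≡ true) (vp : v p zero ≡ true) where

  -- Gaussian elimination: clear the zero coordinate of every other vector using v p.
  reduced : Fin m → Fin d → Bool
  reduced j c = v (punchIn p j) (suc c) xor (v (punchIn p j) zero ∧ v p (suc c))

  reduced-count : suc d < count s → d < count (s ∘ punchIn p)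
  reduced-count d<s = ≤-pred (subst (suc d <_) count-s d<s)
    where
    count-s : count s ≡ suc (count (s ∘ punchIn p))
    count-s = trans (count-remove s p) (cong (λ b → 𝟙 b + count (s ∘ punchIn p)) sp)

  lift : Dependence reduced (s ∘ punchIn p) → Dependence v s
  lift D = record
    { coeff      = coeff
    ; nontrivial = nontrivial
    ; supported  = supported
    ; vanishes   = vanishes
    }
    where
    module D = Dependence D
    t : Bool
    t = ⨁ (λ j → D.coeff j ∧ v (punchIn p j) zero)

    coeff : Fin (suc m) → Bool
    coeff = insertAt D.coeff p t

    nontrivial : ∃ λ i → coeff i ≡ true
    nontrivial = let (j , e) = D.nontrivial in punchIn p j , trans (insertAt-punchIn D.coeff p t j) e

    supported : ∀ i → coeff i ≡ true → s i ≡ true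
    supported i with p ≟ i
    ... | yes refl = λ _ → sp
    ... | no  p≢i  = subst (λ i → coeff i ≡ true → s i ≡ true) (punchIn-punchOut p≢i)
                       (λ e → D.supported _ (trans (sym (insertAt-punchIn D.coeff p t _)) e))

    expand : ∀ c → ⨁ (λ i → coeff i ∧ v i c)
                 ≡ (t ∧ v p c) xor ⨁ (λ j → D.coeff j ∧ v (punchIn p j) c)
    expand c = trans (𝔹Σ.sum-remove {i = p} (λ i → coeff i ∧ v i c))
      (cong₂ _xor_ (cong (_∧ v p c) (insertAt-lookup D.coeff p t))
                   (𝔹Σ.sum-cong-≗ (λ j → cong (_∧ v (punchIn p j) c) (insertAt-punchIn D.coeff p t j))))

    off-pivot : ∀ c → ⨁ (λ j → D.coeff j ∧ v (punchIn p j) (suc c)) ≡ t ∧ v p (suc c)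
    off-pivot c = xor≡false⇒≡ (begin
        ⨁ (λ j → a j ∧ y j) xor (t ∧ b)
      ≡⟨ cong (⨁ (λ j → a j ∧ y j) xor_) (𝔹Σ.*-distribʳ-sum b (λ j → a j ∧ x j)) ⟩
        ⨁ (λ j → a j ∧ y j) xor ⨁ (λ j → (a j ∧ x j) ∧ b)
      ≡⟨ 𝔹Σ.∑-distrib-+ (λ j → a j ∧ y j) (λ j → (a j ∧ x j) ∧ b) ⟨
        ⨁ (λ j → (a j ∧ y j) xor ((a j ∧ x j) ∧ b))
      ≡⟨ 𝔹Σ.sum-cong-≗ (λ j → trans (cong ((a j ∧ y j) xor_) (∧-assoc (a j) (x j) b))
                                     (sym (∧-distribˡ-xor (a j) (y j) (x j ∧ b)))) ⟩
        ⨁ (λ j → a j ∧ reduced j c)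
      ≡⟨ D.vanishes c ⟩
        false
      ∎)
      where
      a x y : Fin m → Bool
      a = D.coeff
      x j = v (punchIn p j) zero
      y j = v (punchIn p j) (suc c)
      b : Bool
      b = v p (suc c)

    vanishes : ∀ c → ⨁ (λ i → coeff i ∧ v i c) ≡ false
    vanishes zero    = trans (expand zero)
      (trans (cong (λ b → (t ∧ b) xor t) vp) (trans (cong (_xor t) (∧-identityʳ t)) (xor-same t)))
    vanishes (suc c) = trans (expand (suc c))
      (trans (cong ((t ∧ v p (suc c)) xor_) (off-pivot c)) (xor-same (t ∧ v p (suc c))))

dependence : ∀ d {m} (v : Fin m → Fin d → Bool) (s : Fin m → Bool) → d < count s → Dependence v s
dependence zero v s 0<s = record
  { coeff = s ; nontrivial = count>0⇒∃ s 0<s ; supported = λ _ e → e ; vanishes = λ () }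
dependence (suc d) {zero}  v s ()
dependence (suc d) {suc m} v s d<s with any? (λ i → s i ∧ v i zero ≟ᵇ true)
... | yes (p , spvp) =
  let (sp , vp) = ∧≡true spvp
      open Pivot v s p sp vp
  in lift (dependence d reduced (s ∘ punchIn p) (reduced-count d<s))
... | no no-pivot =
  dependence-drop-zero zero-column (dependence d (λ i c → v i (suc c)) s (<⇒≤ d<s))
  where
  zero-column : ∀ i → s i ≡ true → v i zero ≡ false
  zero-column i si with v i zero in vi
  ... | false = refl
  ... | true  = contradiction (i , trans (cong (_∧ v i zero) si) vi) no-pivot

-- An even-weight vector is determined by its coordinates 1 … d, so d + 1 of them are dependent.
even-dependence : ∀ d {m} (v : Fin m → Fin (suc d) → Bool) (s : Fin m → Bool) →
                  (∀ i → s i ≡ true → ⨁ (v i) ≡ false) → d < count s → Dependence v s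
even-dependence d v s even d<s = record
  { coeff = coeff ; nontrivial = nontrivial ; supported = supported
  ; vanishes = λ { zero → vanishes-zero ; (suc c) → vanishes c } }
  where
  open Dependence (dependence d (λ i c → v i (suc c)) s d<s)
  combination : Fin (suc d) → Bool
  combination c = ⨁ (λ i → coeff i ∧ v i c)
  total : ⨁ combination ≡ false
  total = begin
    ⨁ (λ c → ⨁ (λ i → coeff i ∧ v i c)) ≡⟨ 𝔹Σ.∑-comm (λ c i → coeff i ∧ v i c) ⟩
    ⨁ (λ i → ⨁ (λ c → coeff i ∧ v i c)) ≡⟨ 𝔹Σ.sum-cong-≗ (λ i → 𝔹Σ.*-distribˡ-sum (coeff i) (v i)) ⟨
    ⨁ (λ i → coeff i ∧ ⨁ (v i))          ≡⟨ ⨁-false (λ i → ∧≡false (even i ∘ supported i)) ⟩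
    false                                ∎
  vanishes-zero : combination zero ≡ false
  vanishes-zero = trans (sym (xor-identityʳ _))
    (trans (cong (combination zero xor_) (sym (⨁-false vanishes))) total)

<ᵇ-asym : ∀ a b → (a <ᵇ b) ≡ true → (b <ᵇ a) ≡ false
<ᵇ-asym zero    zero    ()
<ᵇ-asym zero    (suc b) _ = refl
<ᵇ-asym (suc a) zero    ()
<ᵇ-asym (suc a) (suc b) a<b = <ᵇ-asym a b a<b

<ᵇ-connex : ∀ a b → a ≢ b → 𝟙 (b <ᵇ a) + 𝟙 (a <ᵇ b) ≡ 1
<ᵇ-connex zero    zero    a≢b = contradiction refl a≢b
<ᵇ-connex zero    (suc b) _   = refl
<ᵇ-connex (suc a) zero    _   = refl
<ᵇ-connex (suc a) (suc b) a≢b = <ᵇ-connex a b (a≢b ∘ cong suc)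

𝟙-split : ∀ a {b c} → (a ≡ true → 𝟙 b + 𝟙 c ≡ 1) → 𝟙 a ≡ 𝟙 (b ∧ a) + 𝟙 (c ∧ a)
𝟙-split false {b} {c} _ rewrite ∧-zeroʳ b | ∧-zeroʳ c = refl
𝟙-split true  {b} {c} h rewrite ∧-identityʳ b | ∧-identityʳ c = sym (h refl)

𝟙-∖-split : ∀ a {b c} → (c ≡ true → b ≡ true) → 𝟙 (a ∧ (b ∧ not c)) + 𝟙 (a ∧ c) ≡ 𝟙 (a ∧ b)
𝟙-∖-split false                 _ = refl
𝟙-∖-split true  {true}  {true}  _ = refl
𝟙-∖-split true  {true}  {false} _ = refl
𝟙-∖-split true  {false} {false} _ = refl
𝟙-∖-split true  {false} {true}  h with h refl
... | ()

module _ {n} {G : Graph n} where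

  _⊆_ : EdgeSubset G → EdgeSubset G → Set
  C ⊆ S = ∀ i j → mem C i j ≡ true → mem S i j ≡ true

  _∖_ : EdgeSubset G → EdgeSubset G → EdgeSubset G
  S ∖ C = record
    { mem    = λ i j → mem S i j ∧ not (mem C i j)
    ; memSym = λ i j → cong₂ (λ a b → a ∧ not b) (memSym S i j) (memSym C i j)
    ; sub    = λ i j e → sub S i j (proj₁ (∧≡true e))
    }

  IsEven : EdgeSubset G → Set
  IsEven C = ∀ v → odd? (deg C v) ≡ false

  mem-nonadjacent : (X : EdgeSubset G) {i j : Fin n} → Adj G i j ≡ false → mem X i j ≡ false
  mem-nonadjacent X {i} {j} nonadjacent with mem X i j in e
  ... | false = refl
  ... | true  = contradiction (trans (sym (sub X i j e)) nonadjacent) λ ()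

  size-cong : (X Y : EdgeSubset G) → (∀ i j → mem X i j ≡ mem Y i j) → size X ≡ size Y
  size-cong X Y X≡Y = begin
    size X
      ≡⟨ size≡sum X ⟩
    sum (λ i → sum (λ j → 𝟙 ((toℕ i <ᵇ toℕ j) ∧ mem X i j)))
      ≡⟨ ℕΣ.sum-cong-≗ (λ i → ℕΣ.sum-cong-≗ (λ j → cong (λ b → 𝟙 ((toℕ i <ᵇ toℕ j) ∧ b)) (X≡Y i j))) ⟩
    sum (λ i → sum (λ j → 𝟙 ((toℕ i <ᵇ toℕ j) ∧ mem Y i j)))
      ≡⟨ size≡sum Y ⟨
    size Y
      ∎

  size-pos : (X : EdgeSubset G) {i j : Fin n} → (toℕ i <ᵇ toℕ j) ≡ true → mem X i j ≡ true → 0 < size X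
  size-pos X {i} {j} i<j e = ≤-trans (∃⇒count>0 (rows i) (cong₂ _∧_ i<j e))
    (subst (count (rows i) ≤_) (sym (sumFin≡sum (count ∘ rows))) (≤-sum (count ∘ rows) i))
    where
    rows : Fin n → Fin n → Bool
    rows i j = (toℕ i <ᵇ toℕ j) ∧ mem X i j

  handshake : (X : EdgeSubset G) → sumFin (deg X) ≡ 2 * size X
  handshake X = begin
    sumFin (deg X)                                  ≡⟨ sumFin≡sum (deg X) ⟩
    sum (deg X)                                     ≡⟨ ℕΣ.sum-cong-≗ (λ i → count≡sum (mem X i)) ⟩
    sum (λ i → sum (λ j → 𝟙 (mem X i j)))           ≡⟨ ℕΣ.sum-cong-≗ (λ i → ℕΣ.sum-cong-≗ (split i)) ⟩
    sum (λ i → sum (λ j → below i j + above i j))   ≡⟨ ℕΣ.sum-cong-≗ (λ i → ℕΣ.∑-distrib-+ (below i) (above i)) ⟩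
    sum (λ i → sum (below i) + sum (above i))       ≡⟨ ℕΣ.∑-distrib-+ (sum ∘ below) (sum ∘ above) ⟩
    sum (sum ∘ below) + sum (sum ∘ above)           ≡⟨ cong (_+ sum (sum ∘ above)) (ℕΣ.∑-comm below) ⟩
    sum (λ j → sum (λ i → below i j)) + sum (sum ∘ above)
                                                    ≡⟨ cong (_+ sum (sum ∘ above)) (ℕΣ.sum-cong-≗ below≡above) ⟩
    sum (sum ∘ above) + sum (sum ∘ above)           ≡⟨ cong₂ _+_ (size≡sum X) (size≡sum X) ⟨
    size X + size X                                 ≡⟨ cong (size X +_) (+-identityʳ (size X)) ⟨
    2 * size X                                      ∎
    where
    above below : Fin n → Fin n → ℕ
    above i j = 𝟙 ((toℕ i <ᵇ toℕ j) ∧ mem X i j)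
    below i j = 𝟙 ((toℕ j <ᵇ toℕ i) ∧ mem X i j)
    distinct : ∀ {i j} → mem X i j ≡ true → toℕ i ≢ toℕ j
    distinct {i} e i≡j with toℕ-injective i≡j
    ... | refl = contradiction (trans (sym e) (mem-nonadjacent X (irrefl G i))) λ ()
    split : ∀ i j → 𝟙 (mem X i j) ≡ below i j + above i j
    split i j = 𝟙-split (mem X i j) {toℕ j <ᵇ toℕ i} {toℕ i <ᵇ toℕ j}
                        (λ e → <ᵇ-connex (toℕ i) (toℕ j) (distinct e))
    below≡above : ∀ j → sum (λ i → below i j) ≡ sum (above j)
    below≡above j = ℕΣ.sum-cong-≗ (λ i → cong (λ b → 𝟙 ((toℕ j <ᵇ toℕ i) ∧ b)) (memSym X i j))

  size-∖ : (S C : EdgeSubset G) → C ⊆ S → size (S ∖ C) + size C ≡ size S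
  size-∖ S C C⊆S = begin
    size (S ∖ C) + size C                           ≡⟨ cong₂ _+_ (size≡sum (S ∖ C)) (size≡sum C) ⟩
    sum (sum ∘ kept) + sum (sum ∘ removed)          ≡⟨ ℕΣ.∑-distrib-+ (sum ∘ kept) (sum ∘ removed) ⟨
    sum (λ i → sum (kept i) + sum (removed i))      ≡⟨ ℕΣ.sum-cong-≗ (λ i → ℕΣ.∑-distrib-+ (kept i) (removed i)) ⟨
    sum (λ i → sum (λ j → kept i j + removed i j))  ≡⟨ ℕΣ.sum-cong-≗ (λ i → ℕΣ.sum-cong-≗ (λ j →
                                                         𝟙-∖-split (toℕ i <ᵇ toℕ j) (C⊆S i j))) ⟩
    sum (λ i → sum (λ j → 𝟙 ((toℕ i <ᵇ toℕ j) ∧ mem S i j)))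
                                                    ≡⟨ size≡sum S ⟨
    size S                                          ∎
    where
    kept removed : Fin n → Fin n → ℕ
    kept    i j = 𝟙 ((toℕ i <ᵇ toℕ j) ∧ (mem S i j ∧ not (mem C i j)))
    removed i j = 𝟙 ((toℕ i <ᵇ toℕ j) ∧ mem C i j)

  ∖-isSolution : (S C : EdgeSubset G) → C ⊆ S → IsEven C → IsSolution S → IsSolution (S ∖ C)
  ∖-isSolution S C C⊆S evenC solS v = begin
    deg (S ∖ C) v % 2         ≡⟨ %2≡𝟙odd? (deg (S ∖ C) v) ⟩
    𝟙 (odd? (deg (S ∖ C) v))  ≡⟨ cong 𝟙 same-parity ⟩
    𝟙 (odd? (deg S v))        ≡⟨ %2≡𝟙odd? (deg S v) ⟨
    deg S v % 2               ≡⟨ solS v ⟩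
    1                         ∎
    where
    same-parity : odd? (deg (S ∖ C) v) ≡ odd? (deg S v)
    same-parity = begin
      odd? (deg (S ∖ C) v)                   ≡⟨ odd?-count (mem (S ∖ C) v) ⟩
      ⨁ (λ j → mem S v j ∧ not (mem C v j)) ≡⟨ 𝔹Σ.sum-cong-≗ (λ j → ∧-not≡xor (C⊆S v j)) ⟩
      ⨁ (λ j → mem S v j xor mem C v j)     ≡⟨ 𝔹Σ.∑-distrib-+ (mem S v) (mem C v) ⟩
      ⨁ (mem S v) xor ⨁ (mem C v)           ≡⟨ cong₂ _xor_ (odd?-count (mem S v)) (odd?-count (mem C v)) ⟨
      odd? (deg S v) xor odd? (deg C v)     ≡⟨ cong (odd? (deg S v) xor_) (evenC v) ⟩
      odd? (deg S v) xor false              ≡⟨ xor-identityʳ (odd? (deg S v)) ⟩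
      odd? (deg S v)                        ∎

incidence : ∀ {n} → Fin n → Fin n → Fin n → Bool
incidence i j c = δ i c xor δ j c

incidence-even : ∀ {n} (i j : Fin n) → ⨁ (incidence i j) ≡ false
incidence-even i j = trans (𝔹Σ.∑-distrib-+ (δ i) (δ j)) (cong₂ _xor_ (⨁-δ-row i) (⨁-δ-row j))
  where
  ⨁-δ-row : ∀ i → ⨁ (δ i) ≡ true
  ⨁-δ-row i = trans (𝔹Σ.sum-cong-≗ (δ-sym i)) (⨁-δ (λ _ → true) i)

-- The boundary of the edge chain M, evaluated at the vertex v.
⨁-boundary : ∀ {n} (M : Fin n → Fin n → Bool) v →
             ⨁ (λ i → ⨁ (λ j → M i j ∧ incidence i j v)) ≡ ⨁ (M v) xor ⨁ (λ i → M i v)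
⨁-boundary M v = begin
  ⨁ (λ i → ⨁ (λ j → M i j ∧ (δ i v xor δ j v)))
    ≡⟨ 𝔹Σ.sum-cong-≗ (λ i → trans (𝔹Σ.sum-cong-≗ (λ j → ∧-distribˡ-xor (M i j) (δ i v) (δ j v)))
                                  (𝔹Σ.∑-distrib-+ (λ j → M i j ∧ δ i v) (λ j → M i j ∧ δ j v))) ⟩
  ⨁ (λ i → ⨁ (λ j → M i j ∧ δ i v) xor ⨁ (λ j → M i j ∧ δ j v))
    ≡⟨ 𝔹Σ.∑-distrib-+ (λ i → ⨁ (λ j → M i j ∧ δ i v)) (λ i → ⨁ (λ j → M i j ∧ δ j v)) ⟩
  ⨁ (λ i → ⨁ (λ j → M i j ∧ δ i v)) xor ⨁ (λ i → ⨁ (λ j → M i j ∧ δ j v))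
    ≡⟨ cong₂ _xor_ (trans (𝔹Σ.sum-cong-≗ (λ i → sym (𝔹Σ.*-distribʳ-sum (δ i v) (M i))))
                          (⨁-δ (λ i → ⨁ (M i)) v))
                   (𝔹Σ.sum-cong-≗ (λ i → ⨁-δ (M i) v)) ⟩
  ⨁ (M v) xor ⨁ (λ i → M i v)
    ∎

module _ {d} {G : Graph (suc d)} (S : EdgeSubset G) where

  selected : Fin (suc d) → Fin (suc d) → Bool
  selected i j = (toℕ i <ᵇ toℕ j) ∧ mem S i j

  count-selected : count (atPair selected) ≡ size S
  count-selected = begin
    count (atPair selected)
      ≡⟨ count≡sum (atPair selected) ⟩
    sum (𝟙 ∘ atPair selected)
      ≡⟨ sum-combine +-0-monoid {suc d} {suc d} (𝟙 ∘ atPair selected) ⟩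
    sum (λ i → sum (λ j → 𝟙 (atPair selected (combine {suc d} {suc d} i j))))
      ≡⟨ ℕΣ.sum-cong-≗ (λ i → ℕΣ.sum-cong-≗ (λ j → cong 𝟙 (atPair-combine selected i j))) ⟩
    sum (λ i → sum (λ j → 𝟙 (selected i j)))
      ≡⟨ size≡sum S ⟨
    size S
      ∎

  -- The incidence vectors of n ≤ |S| edges are dependent; a dependence is an even subgraph.
  even-subgraph : suc d ≤ size S → Σ (EdgeSubset G) λ C → C ⊆ S × IsEven C × 0 < size C
  even-subgraph n≤S = C , in-S , evenC , size-pos C {i} {j} i<j ij∈C
    where
    incidences-even : (e : Fin (suc d * suc d)) → atPair selected e ≡ true →
                      ⨁ (atPair {suc d} incidence e) ≡ false
    incidences-even e _ = incidence-even (proj₁ (remQuot {suc d} (suc d) e)) (proj₂ (remQuot {suc d} (suc d) e))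

    edges-dependent : Dependence (atPair incidence) (atPair selected)
    edges-dependent = even-dependence d (atPair incidence) (atPair selected) incidences-even
                                      (subst (suc d ≤_) (sym count-selected) n≤S)

    open Dependence edges-dependent

    M : Fin (suc d) → Fin (suc d) → Bool
    M i j = coeff (combine i j)

    M⇒selected : ∀ {i j} → M i j ≡ true → selected i j ≡ true
    M⇒selected {i} {j} e = trans (sym (atPair-combine selected i j)) (supported (combine i j) e)

    in-S : ∀ i j → M i j xor M j i ≡ true → mem S i j ≡ true
    in-S i j e with M i j in mij
    ... | true  = proj₂ (∧≡true (M⇒selected {i} {j} mij))
    ... | false = trans (memSym S i j) (proj₂ (∧≡true (M⇒selected {j} {i} e)))

    C : EdgeSubset G
    C = record
      { mem    = λ i j → M i j xor M j i
      ; memSym = λ i j → xor-comm (M i j) (M j i)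
      ; sub    = λ i j e → sub S i j (in-S i j e)
      }

    evenC : IsEven C
    evenC v = begin
      odd? (deg C v)                                  ≡⟨ odd?-count (mem C v) ⟩
      ⨁ (λ j → M v j xor M j v)                      ≡⟨ 𝔹Σ.∑-distrib-+ (M v) (λ j → M j v) ⟩
      ⨁ (M v) xor ⨁ (λ j → M j v)                    ≡⟨ ⨁-boundary M v ⟨
      ⨁ (λ i → ⨁ (λ j → M i j ∧ incidence i j v))   ≡⟨ flatten ⟨
      ⨁ (λ e → coeff e ∧ atPair incidence e v)       ≡⟨ vanishes v ⟩
      false                                           ∎
      where
      flatten : ⨁ (λ e → coeff e ∧ atPair incidence e v) ≡ ⨁ (λ i → ⨁ (λ j → M i j ∧ incidence i j v))
      flatten = trans
        (sum-combine xor-monoid {suc d} {suc d} (λ e → coeff e ∧ atPair incidence e v))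
        (𝔹Σ.sum-cong-≗ (λ i → 𝔹Σ.sum-cong-≗ (λ j →
          cong (λ w → M i j ∧ w v) (atPair-combine incidence i j))))

    i j : Fin (suc d)
    i = proj₁ (remQuot {suc d} (suc d) (proj₁ nontrivial))
    j = proj₂ (remQuot {suc d} (suc d) (proj₁ nontrivial))

    Mij : M i j ≡ true
    Mij = trans (cong coeff (combine-remQuot {suc d} (suc d) (proj₁ nontrivial))) (proj₂ nontrivial)

    i<j : (toℕ i <ᵇ toℕ j) ≡ true
    i<j = proj₁ (∧≡true (M⇒selected {i} {j} Mij))

    ij∈C : M i j xor M j i ≡ true
    ij∈C with M j i in mji
    ... | false = trans (xor-identityʳ (M i j)) Mij
    ... | true  = contradiction
      (trans (sym (<ᵇ-asym (toℕ i) (toℕ j) i<j)) (proj₁ (∧≡true (M⇒selected {j} {i} mji)))) λ ()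

optimal-size< : ∀ {d} {G : Graph (suc d)} (S : EdgeSubset G) → IsOptimal S → size S < suc d
optimal-size< {d} S (solS , minimal) with suc d ≤? size S
... | no  n≰S = ≰⇒> n≰S
... | yes n≤S =
  let (C , C⊆S , evenC , 0<C) = even-subgraph S n≤S
      smaller : size (S ∖ C) < size S
      smaller = subst (size (S ∖ C) <_) (size-∖ S C C⊆S) (m<m+n (size (S ∖ C)) 0<C)
  in contradiction (minimal (S ∖ C) (∖-isSolution S C C⊆S evenC solS)) (<⇒≱ smaller)

odd⇒≥1 : ∀ x → x % 2 ≡ 1 → 1 ≤ x
odd⇒≥1 (suc x) _ = s≤s z≤n

solution-size≥ : ∀ {n} {G : Graph n} (S : EdgeSubset G) → IsSolution S → n ≤ 2 * size S
solution-size≥ S solS =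
  subst (_ ≤_) (handshake S) (n≤sumFin (deg S) (λ v → odd⇒≥1 (deg S v) (solS v)))

size≥half : ∀ {k} {G : Graph (2 * suc k)} (S : EdgeSubset G) → IsSolution S → suc k ≤ size S
size≥half S solS = *-cancelˡ-≤ 2 (solution-size≥ S solS)

-- Extremal examples

allEdges : ∀ {n} (G : Graph n) → EdgeSubset G
allEdges G = record { mem = Adj G ; memSym = Graph.sym G ; sub = λ _ _ e → e }

perfect-matching-optimal : ∀ {k} {G : Graph (2 * suc k)} (M : EdgeSubset G) → (∀ v → deg M v ≡ 1) →
                           IsOptimal M × (∀ S → IsOptimal S → size S ≡ suc k)
perfect-matching-optimal {k} M perfect =
  (solM , λ Y solY → subst (_≤ size Y) (sym sizeM) (size≥half Y solY)) ,
  λ S (solS , minS) → ≤-antisym (subst (size S ≤_) sizeM (minS M solM)) (size≥half S solS)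
  where
  solM : IsSolution M
  solM v = cong (_% 2) (perfect v)
  sizeM : size M ≡ suc k
  sizeM = *-cancelˡ-≡ (size M) (suc k) 2 (begin
    2 * size M                    ≡⟨ handshake M ⟨
    sumFin (deg M)                ≡⟨ sumFin-cong {2 * suc k} perfect ⟩
    sumFin {2 * suc k} (λ _ → 1)  ≡⟨ sumFin-const-1 (2 * suc k) ⟩
    2 * suc k                     ∎)

complete : ∀ n → Graph n
complete n = record
  { Adj    = λ i j → not (δ i j)
  ; sym    = λ i j → cong not (δ-sym i j)
  ; irrefl = λ i → cong not (δ-refl i)
  }

complete-connected : ∀ n → Connected (complete n)
complete-connected n u v with u ≟ v
... | yes refl = ε
... | no  u≢v  = cong not (dec-false (u ≟ v) u≢v) ◅ ε

-- Pairs 2i with 2i + 1.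
paired : ∀ {m} → Fin m → Fin m → Bool
paired zero          (suc zero)    = true
paired (suc zero)    zero          = true
paired (suc (suc i)) (suc (suc j)) = paired i j
paired _             _             = false

paired-sym : ∀ {m} (i j : Fin m) → paired i j ≡ paired j i
paired-sym zero          zero          = refl
paired-sym zero          (suc zero)    = refl
paired-sym zero          (suc (suc j)) = refl
paired-sym (suc zero)    zero          = refl
paired-sym (suc zero)    (suc zero)    = refl
paired-sym (suc zero)    (suc (suc j)) = refl
paired-sym (suc (suc i)) zero          = refl
paired-sym (suc (suc i)) (suc zero)    = refl
paired-sym (suc (suc i)) (suc (suc j)) = paired-sym i j

paired-irrefl : ∀ {m} (i : Fin m) → paired i i ≡ false
paired-irrefl zero          = refl
paired-irrefl (suc zero)    = refl
paired-irrefl (suc (suc i)) = paired-irrefl i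

paired-deg : ∀ k (v : Fin (k * 2)) → count (paired v) ≡ 1
paired-deg (suc k) zero          = cong suc (count-false {k * 2} (λ _ → false) (λ _ → refl))
paired-deg (suc k) (suc zero)    = cong suc (count-false {k * 2} (λ _ → false) (λ _ → refl))
paired-deg (suc k) (suc (suc v)) = paired-deg k v

matching : ∀ k → EdgeSubset (complete (2 * suc k))
matching k = record
  { mem = paired ; memSym = paired-sym ; sub = λ i j e → cong not (dec-false (i ≟ j) (distinct e)) }
  where
  distinct : ∀ {i j} → paired {2 * suc k} i j ≡ true → i ≢ j
  distinct {i} e refl = contradiction (trans (sym e) (paired-irrefl i)) λ ()

matching-perfect : ∀ k v → deg (matching k) v ≡ 1
matching-perfect k =
  subst (λ m → (v : Fin m) → count (paired v) ≡ 1) (*-comm (suc k) 2) (paired-deg (suc k))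

starAdj : ∀ {m} → Fin m → Fin m → Bool
starAdj zero    (suc _) = true
starAdj (suc _) zero    = true
starAdj _       _       = false

star : ∀ d → Graph (suc d)
star d = record { Adj = starAdj ; sym = symmetric ; irrefl = λ { zero → refl ; (suc _) → refl } }
  where
  symmetric : ∀ i j → starAdj {suc d} i j ≡ starAdj j i
  symmetric zero    zero    = refl
  symmetric zero    (suc _) = refl
  symmetric (suc _) zero    = refl
  symmetric (suc _) (suc _) = refl

star-connected : ∀ d → Connected (star d)
star-connected d zero    zero    = ε
star-connected d zero    (suc b) = refl ◅ ε
star-connected d (suc a) zero    = refl ◅ ε
star-connected d (suc a) (suc b) = _◅_ {j = zero} refl (refl ◅ ε)

star-solution-unique : ∀ {d} (Y : EdgeSubset (star d)) → IsSolution Y →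
                       ∀ i j → mem Y i j ≡ starAdj i j
star-solution-unique Y solY = λ where
    zero    zero    → mem-nonadjacent Y refl
    zero    (suc b) → trans (memSym Y zero (suc b)) (leaf b)
    (suc a) zero    → leaf a
    (suc a) (suc b) → mem-nonadjacent Y refl
  where
  𝟙-odd : ∀ {b} → 𝟙 b % 2 ≡ 1 → b ≡ true
  𝟙-odd {true} _ = refl
  leaf : ∀ a → mem Y (suc a) zero ≡ true
  leaf a = 𝟙-odd (subst (λ x → x % 2 ≡ 1) deg-leaf (solY (suc a)))
    where
    deg-leaf : deg Y (suc a) ≡ 𝟙 (mem Y (suc a) zero)
    deg-leaf = trans (cong (𝟙 (mem Y (suc a) zero) +_) (count-false _ no-leaf-leaf-edge)) (+-identityʳ _)
      where
      no-leaf-leaf-edge : ∀ l → mem Y (suc a) (suc l) ≡ false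
      no-leaf-leaf-edge l = mem-nonadjacent Y refl

star-optimal : ∀ d → odd? d ≡ true →
               IsOptimal (allEdges (star d)) × (∀ S → IsOptimal S → size S ≡ d)
star-optimal d odd-d = (solution , λ Y solY → ≤-reflexive (same-size Y solY)) ,
                       λ S (solS , _) → trans (sym (same-size S solS)) size-star
  where
  centre-degree : deg (allEdges (star d)) zero ≡ d
  centre-degree = count-true d
  leaf-degree : ∀ a → deg (allEdges (star d)) (suc a) ≡ 1
  leaf-degree a = cong suc (count-false {d} (λ _ → false) (λ _ → refl))
  solution : IsSolution (allEdges (star d))
  solution zero    = trans (cong (_% 2) centre-degree) (trans (%2≡𝟙odd? d) (cong 𝟙 odd-d))
  solution (suc a) = cong (_% 2) (leaf-degree a)
  same-size : ∀ Y → IsSolution Y → size (allEdges (star d)) ≡ size Y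
  same-size Y solY = size-cong (allEdges (star d)) Y (λ i j → sym (star-solution-unique Y solY i j))
  size-star : size (allEdges (star d)) ≡ d
  size-star = *-cancelˡ-≡ _ d 2 (begin
    2 * size (allEdges (star d))      ≡⟨ handshake (allEdges (star d)) ⟨
    sumFin (deg (allEdges (star d)))  ≡⟨ cong₂ _+_ centre-degree (sumFin-cong leaf-degree) ⟩
    d + sumFin {d} (λ _ → 1)          ≡⟨ cong (d +_) (sumFin-const-1 d) ⟩
    d + d                             ≡⟨ cong (d +_) (+-identityʳ d) ⟨
    2 * d                             ∎)

theorem3p3 : ((k : ℕ) (G : Graph (2 * suc k)) → Connected G →
                  (S : EdgeSubset G) → IsOptimal S →
                  (suc k ≤ size S) × (size S + 1 ≤ 2 * suc k))
             × ((k : ℕ) →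
                  (Σ (Graph (2 * suc k)) λ G → Connected G
                     × (∃ λ (S : EdgeSubset G) → IsOptimal S)
                     × (∀ (S : EdgeSubset G) → IsOptimal S → size S ≡ suc k))
                × (Σ (Graph (2 * suc k)) λ G → Connected G
                     × (∃ λ (S : EdgeSubset G) → IsOptimal S)
                     × (∀ (S : EdgeSubset G) → IsOptimal S → size S + 1 ≡ 2 * suc k)))
theorem3p3 =
    -- The bounds hold without connectivity.
    (λ k G _ S optimal →
       size≥half S (proj₁ optimal) , subst (_≤ 2 * suc k) (+-comm 1 (size S)) (optimal-size< S optimal))
  , λ k →
      let (matching-opt , matching-sizes) = perfect-matching-optimal (matching k) (matching-perfect k)
          (star-opt , star-sizes)         = star-optimal (pred (2 * suc k)) (odd?-pred-double k)
      in  ( complete (2 * suc k) , complete-connected (2 * suc k)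
          , (matching k , matching-opt) , matching-sizes )
        , ( star (pred (2 * suc k)) , star-connected (pred (2 * suc k))
          , (allEdges (star _) , star-opt)
          , λ S opt → trans (+-comm (size S) 1) (cong suc (star-sizes S opt)) )
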